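{- Let $p$ be a prime and let $(\Omega,S)$ be a coherent configuration with fibers $\Omega_1,\dots,\Omega_m$ such that $(\Omega_i,S_i)\simeq C_p\wr C_p$ for each $i$, $n_s=p$ for each $s\in\bigcup_{i\ne j}S_{ij}$, and $S=\bigcup_{i=1}^mS_i\cup(S\setminus R)$ where $R$ is the set of regular elements of $S$. Fix $\alpha_i\in\Omega_i$ ($1\le i\le m$), $t_1\in\mathbf{O}_\theta(S_1)\setminus\{1_{\Omega_1}\}$, and for $i\ge2$ let $t_i$ be the unique element of $\mathbf{O}_\theta(S_i)$ with $r(\alpha_1t_1,\alpha_it_i)=r(\alpha_1,\alpha_i)$. For each $i$ let $\{\alpha_{ik}\mid k=1,\dots,p\}$ be a complete set of representatives of the equivalence relation $\bigcup_{t\in\mathbf{O}_\theta(S_i)}t$ on $\Omega_i$. For $s\in S_{ij}$ with $i\ne j$ and $k,l\in\{1,\dots,p\}$ let $h(s)_{kl}\in\mathbb{Z}_p$ be the unique element with $r(\alpha_{ik},\alpha_{jl}t_j^{h(s)_{kl}})=s$. Then for each $s\in S_{ij}$ with $i\ne j$, the matrix $(h(s)_{kl})\in M_{p\times p}(\mathbb{Z}_p)$ satisfies $\{h(s)_{k_1l}-h(s)_{k_2l}\mid l=1,\dots,p\}=\mathbb{Z}_p$ for all distinct $k_1,k_2\in\{1,\dots,p\}$; that is, it is a generalized Hadamard matrix of degree $p$ over $\mathbb{Z}_p$. Equivalently, $(\xi^{h(s)_{kl}})\in M_{p\times p}(\mathbb{C})$ is a complex Hadamard matrix of Butson type $(p,p)$,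 where $\xi$ is a primitive $p$-th root of unity.
   Context: A coherent configuration is a pair $(\Omega,S)$ of a finite set $\Omega$ and a partition $S$ of $\Omega\times\Omega$ such that $1_\Omega$ is a union of elements of $S$, $s^\ast:=\{(\beta,\alpha)\mid(\alpha,\beta)\in s\}\in S$ for $s\in S$, and $\sigma_s\sigma_t=\sum_{u\in S}c_{st}^u\sigma_u$ with nonnegative integers $c_{st}^u$, where $\sigma_u$ is the adjacency matrix of $u$. Fibers are the sets $\Delta$ with $1_\Delta\in S$; they partition $\Omega$. $S_{ij}:=\{s\in S\mid s\subseteq\Omega_i\times\Omega_j\}$, $S_i:=S_{ii}$. For $s\in S_{ij}$, $n_s:=|\{\beta\mid(\alpha,\beta)\in s\}|$ for any $\alpha\in\Omega_i$. $\mathbf{O}_\theta(S_i):=\{t\in S_i\mid n_t=1\}$, a cyclic group of order $p$ under relational composition; for $u\in\mathbf{O}_\theta(S_i)$ and $\beta\in\Omega_i$, $\beta u$ is the unique $\gamma$ with $(\beta,\gamma)\in u$, and $t_i^a$ is the $a$-fold composition. $r(\alpha,\beta)$ is the unique element of $S$ containing $(\alpha,\beta)$. An element $s$ is regular if $ss^\ast s=\{s\}$, using the complex product $TU:=\{s\mid c_{tu}^s>0$ for some $t\in T,u\in U\}$. $C_p\wr C_p$ is the association scheme on $\mathbb{Z}_p\times\mathbb{Z}_p$ with relations $\{((x,y),(x+a,y))\}$ ($a\in\mathbb{Z}_p$) and $\{((x_1,y),(x_2,y+b))\}$ ($b\ne0$). A complex Hadamard matrix of Butson type $(p,p)$ is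 a $p\times p$ matrix whose entries are $p$-th roots of unity and whose rows are pairwise orthogonal with respect to the standard Hermitian inner product. -}

module Defs where

open import Data.Nat using (ℕ; _+_; _∸_; _<_; _≤ᵇ_)
open import Data.Bool using (Bool; true; false; if_then_else_; _∧_)
open import Data.Fin using (Fin; toℕ; zero; suc) renaming (_≟_ to _≟F_)
open import Data.Product using (Σ; _×_; _,_; ∃; ∃-syntax)
open import Data.Sum using (_⊎_; inj₁; inj₂)
open import Relation.Nullary using (¬_; does)
open import Relation.Binary.PropositionalEquality using (_≡_)
open import Function.Definitions using (Injective)
open import Function.Bundles using (_⇔_)

countFin : ∀ {n} → (Fin n → Bool) → ℕ
countFin {ℕ.zero}  f = 0
countFin {ℕ.suc n} f = (if f zero then 1 else 0) + countFin (λ i → f (suc i))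

-- Arithmetic of ℤ_p, realised on Fin p: (a - b) mod p, as a natural < p

subMod : ∀ {p} → Fin p → Fin p → ℕ
subMod {p} a b =
  if toℕ b ≤ᵇ toℕ a then toℕ a ∸ toℕ b else (toℕ a + p) ∸ toℕ b

-- The scheme C_p ≀ C_p on ℤ_p × ℤ_p, given by its colouring:
-- ((x1,y1),(x2,y2)) has colour inj₁ (x2 - x1) if y1 = y2 (relation
-- {((x,y),(x+a,y))}), and colour inj₂ (y2 - y1) otherwise (relation
-- {((x1,y),(x2,y+b))}, b ≠ 0).

wrCol : ∀ {p} → Fin p × Fin p → Fin p × Fin p → ℕ ⊎ ℕ
wrCol (x₁ , y₁) (x₂ , y₂) =
  if does (y₁ ≟F y₂) then inj₁ (subMod x₂ x₁) else inj₂ (subMod y₂ y₁)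

-- Coherent configurations on Ω = Fin N with the partition S given by a
-- colouring r : Ω × Ω → Fin d (colour c ↦ the relation r⁻¹(c));
-- r α β is the paper's r(α,β).

record CoherentConfiguration (N d : ℕ) : Set where
  field
    r : Fin N → Fin N → Fin d
    r-surj : ∀ (s : Fin d) → ∃[ α ] ∃[ β ] r α β ≡ s
    -- 1_Ω is a union of elements of S
    diag : ∀ α β γ → r α β ≡ r γ γ → α ≡ β
    _* : Fin d → Fin d
    conv : ∀ α β → r β α ≡ (r α β) *
    -- σ_s σ_t = Σ_u c_st^u σ_u : the number of γ with (α,γ) ∈ s,
    -- (γ,β) ∈ t depends only on the colour of (α,β)
    coherent : ∀ (s t : Fin d) α β α′ β′ → r α β ≡ r α′ β′ →
      countFin (λ γ → does (r α γ ≟F s) ∧ does (r γ β ≟F t))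
        ≡ countFin (λ γ → does (r α′ γ ≟F s) ∧ does (r γ β′ ≟F t))

open CoherentConfiguration public

module _ {N d : ℕ} (C : CoherentConfiguration N d) where

  private
    ρ = r C

  -- Fibers are indexed by their identity colours e = 1_Δ
  IsFiber : Fin d → Set
  IsFiber e = ∃[ α ] ρ α α ≡ e

  _∈F_ : Fin N → Fin d → Set
  α ∈F e = ρ α α ≡ e

  InS : Fin d → Fin d → Fin d → Set
  InS e f s = IsFiber e × IsFiber f × (∀ α β → ρ α β ≡ s → (α ∈F e) × (β ∈F f))

  nval : Fin d → Fin N → ℕ
  nval s α = countFin (λ β → does (ρ α β ≟F s))

  cAt : Fin d → Fin d → Fin N → Fin N → ℕ
  cAt s t α β = countFin (λ γ → does (ρ α γ ≟F s) ∧ does (ρ γ β ≟F t))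

  cPos : Fin d → Fin d → Fin d → Set
  cPos s t u = ∃[ α ] ∃[ β ] (ρ α β ≡ u × 0 < cAt s t α β)

  cprod : (Fin d → Set) → (Fin d → Set) → (Fin d → Set)
  cprod T U s = ∃[ t ] ∃[ u ] (T t × U u × cPos t u s)

  single : Fin d → (Fin d → Set)
  single s u = u ≡ s

  Regular : Fin d → Set
  Regular s = ∀ u → cprod (cprod (single s) (single ((C *) s))) (single s) u ⇔ (u ≡ s)

  Thin : Fin d → Fin d → Set
  Thin e u = InS e e u × (∀ α → α ∈F e → nval u α ≡ 1)

  Iter : Fin d → ℕ → Fin N → Fin N → Set
  Iter u ℕ.zero    β γ = β ≡ γ
  Iter u (ℕ.suc a) β γ = ∃[ δ ] (ρ β δ ≡ u × Iter u a δ γ)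

  ThinEquiv : Fin d → Fin N → Fin N → Set
  ThinEquiv e β γ = ∃[ u ] (Thin e u × ρ β γ ≡ u)

  IsoWr : (p : ℕ) → Fin d → Set
  IsoWr p e =
    Σ (Fin p × Fin p → Fin N) λ φ →
      Injective _≡_ _≡_ φ ×
      (∀ x → φ x ∈F e) ×
      (∀ α → α ∈F e → ∃[ x ] φ x ≡ α) ×
      (∀ x y x′ y′ → (ρ (φ x) (φ y) ≡ ρ (φ x′) (φ y′)) ⇔ (wrCol x y ≡ wrCol x′ y′))

{-# OPTIONS --safe #-}
-- Coordinatise every fibre as C_p ≀ C_p; its thin relations are then the translations x ↦ x + a inside
-- the blocks {(x, y) | x ∈ ℤ_p}. The key fact concerns a non-regular colour σ ∈ S_ij (i ≠ j) whose
-- converse has valency p: no two points of a block of Ω_i have a common σ-target, since coherence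
-- would spread such a coincidence over whole blocks and the valency bound would then force
-- σ σ⋆ σ = {σ}. By counting, every point of Ω_j has exactly one σ-source in each block of Ω_i.
-- For s and s⋆ this determines h(s): a representative α sees the whole block of another
-- representative α′ in one colour, so coherence transports every offset n·D (D ≠ 0 the step of t_j)
-- inside the block of an s-target of α′ to the offset between the s-targets of α′ and α in some
-- block l. As p is prime, every difference h(s)_{k₁l} - h(s)_{k₂l} occurs. That t_j ≠ 1 follows
-- from t_1 ≠ 1 by the same uniqueness of sources.
module Submission where

open import Defs
open import Data.Bool using (Bool; true; false; T)
open import Data.Bool.Properties using (T-∧)
open import Data.Empty using (⊥-elim)
open import Data.Fin using (Fin; zero; suc; toℕ; fromℕ<; punchOut) renaming (_≟_ to _≟F_)
open import Data.Fin.Properties using (toℕ-injective; toℕ<n; toℕ-fromℕ<; suc-injective; injective⇒≤; punchOut-injective; any?)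
open import Data.Nat using (ℕ; zero; suc; pred; _+_; _*_; _∸_; _%_; _≤_; _<_; _≤ᵇ_; z≤n; s≤s; z<s; NonZero; NonTrivial; >-nonZero; >-nonZero⁻¹; nonTrivial⇒nonZero; nonTrivial⇒n>1)
open import Data.Nat.DivMod using (%-distribˡ-+; [m+kn]%n≡m%n; [m+n]%n≡m%n; m%n%n≡m%n; m%n<n; m<n⇒m%n≡m)
open import Data.Nat.Divisibility using (m%n≡0⇒n∣m; n∣m⇒m%n≡0; ∣⇒≤)
open import Data.Nat.Primality using (Prime; euclidsLemma; prime⇒nonZero; prime⇒nonTrivial)
open import Data.Nat.Properties
  using (*-distribʳ-+; +-assoc; +-comm; +-identityʳ; +-monoˡ-<; <⇒≢; <⇒≤; <⇒≱; m+[n∸m]≡n; m<n+o⇒m∸n<o; m∸n≤m;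
         m≤n+m; n≢0⇒n>0; n≮n; suc-pred; ≤-<-trans; ≤-antisym; ≤-total; ≤-trans; ≤ᵇ⇒≤; ≤⇒≤ᵇ; ≰⇒>)
open import Data.Nat.Tactic.RingSolver using (solve-∀)
open import Data.Product using (_×_; _,_; ∃-syntax; proj₁; proj₂)
open import Data.Sum using (inj₁; inj₂)
open import Data.Sum.Properties using (inj₁-injective)
open import Data.Unit using (tt)
open import Function using (_∘_; _∘′_)
open import Function.Bundles using (Equivalence; _⇔_; mk⇔)
open import Function.Definitions using (Injective)
open import Relation.Binary.PropositionalEquality
open import Relation.Nullary using (¬_; does; yes; no; contradiction)

module Counting where

  private
    select : ∀ {n} (f : Fin n → Bool) → Fin (countFin f) → Fin n
    select {suc n} f i with f zero
    select {suc n} f zero    | true  = zero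
    select {suc n} f (suc i) | true  = suc (select (λ j → f (suc j)) i)
    select {suc n} f i       | false = suc (select (λ j → f (suc j)) i)

    select-holds : ∀ {n} (f : Fin n → Bool) i → T (f (select f i))
    select-holds {suc n} f i with f zero in eq
    select-holds {suc n} f zero    | true  = subst T (sym eq) tt
    select-holds {suc n} f (suc i) | true  = select-holds (λ j → f (suc j)) i
    select-holds {suc n} f i       | false = select-holds (λ j → f (suc j)) i

    select-injective : ∀ {n} (f : Fin n → Bool) → Injective _≡_ _≡_ (select f)
    select-injective {suc n} f {i} {i′} with f zero
    select-injective {suc n} f {zero}  {zero}   | true = λ _ → refl
    select-injective {suc n} f {zero}  {suc _}  | true = λ ()
    select-injective {suc n} f {suc _} {zero}   | true = λ ()
    select-injective {suc n} f {suc i} {suc i′} | true =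
      cong suc ∘′ select-injective (λ j → f (suc j)) ∘′ suc-injective
    select-injective {suc n} f {i} {i′} | false =
      select-injective (λ j → f (suc j)) ∘′ suc-injective

    select-surjective : ∀ {n} (f : Fin n → Bool) j → T (f j) → ∃[ i ] select f i ≡ j
    select-surjective {suc n} f j fj with f zero in eq
    select-surjective {suc n} f zero    fj | true = zero , refl
    select-surjective {suc n} f (suc j) fj | true
      with i , refl ← select-surjective (λ k → f (suc k)) j fj = suc i , refl
    select-surjective {suc n} f zero    fj | false = ⊥-elim (subst T eq fj)
    select-surjective {suc n} f (suc j) fj | false
      with i , refl ← select-surjective (λ k → f (suc k)) j fj = i , refl

  injective⇒≤countFin : ∀ {m n} (f : Fin n → Bool) (ι : Fin m → Fin n) →
    Injective _≡_ _≡_ ι → (∀ i → T (f (ι i))) → m ≤ countFin f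
  injective⇒≤countFin f ι ι-inj holds = injective⇒≤ index-injective
    where
    index : _ → Fin (countFin f)
    index i = proj₁ (select-surjective f (ι i) (holds i))
    index-injective : Injective _≡_ _≡_ index
    index-injective {i} {i′} eq = ι-inj (begin
      ι i                  ≡⟨ proj₂ (select-surjective f (ι i) (holds i)) ⟨
      select f (index i)   ≡⟨ cong (select f) eq ⟩
      select f (index i′)  ≡⟨ proj₂ (select-surjective f (ι i′) (holds i′)) ⟩
      ι i′                 ∎)
      where open ≡-Reasoning

  injective⇒countFin≤ : ∀ {m n} (f : Fin n → Bool) (κ : ∀ j → T (f j) → Fin m) →
    (∀ {j j′} fj fj′ → κ j fj ≡ κ j′ fj′ → j ≡ j′) → countFin f ≤ m
  injective⇒countFin≤ f κ κ-inj =
    injective⇒≤ (select-injective f ∘′ κ-inj (select-holds f _) (select-holds f _))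

  countFin>0⇒∃ : ∀ {n} (f : Fin n → Bool) → 0 < countFin f → ∃[ j ] T (f j)
  countFin>0⇒∃ f pos with countFin f | select f | select-holds f
  ... | suc _ | sel | holds = sel zero , holds zero

  ∃⇒countFin>0 : ∀ {n} (f : Fin n → Bool) {j} → T (f j) → 0 < countFin f
  ∃⇒countFin>0 f {j} fj = injective⇒≤countFin f (λ (_ : Fin 1) → j) (λ { {zero} {zero} _ → refl }) (λ _ → fj)

  injective⇒countFin< : ∀ {m n} (f : Fin n → Bool) (κ : ∀ j → T (f j) → Fin m) →
    (∀ {j j′} fj fj′ → κ j fj ≡ κ j′ fj′ → j ≡ j′) → (b : Fin m) → (∀ j fj → κ j fj ≢ b) → countFin f < m
  injective⇒countFin< {suc m} f κ κ-inj b missed =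
    s≤s (injective⇒countFin≤ f (λ j fj → punchOut (missed j fj ∘′ sym))
      (λ {j} {j′} fj fj′ eq → κ-inj fj fj′ (punchOut-injective (missed j fj ∘′ sym) (missed j′ fj′ ∘′ sym) eq)))

module Residues (p : ℕ) .{{_ : NonZero p}} where

  infix 4 _≡ₚ_
  _≡ₚ_ : ℕ → ℕ → Set
  m ≡ₚ n = m % p ≡ n % p

  %-≡ₚ : ∀ m → m % p ≡ₚ m
  %-≡ₚ m = m%n%n≡m%n m p

  +-congˡₚ : ∀ m {n o} → n ≡ₚ o → m + n ≡ₚ m + o
  +-congˡₚ m {n} {o} n≡o = begin
    (m + n) % p          ≡⟨ %-distribˡ-+ m n p ⟩
    (m % p + n % p) % p  ≡⟨ cong (λ k → (m % p + k) % p) n≡o ⟩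
    (m % p + o % p) % p  ≡⟨ %-distribˡ-+ m o p ⟨
    (m + o) % p          ∎
    where open ≡-Reasoning

  +-cancelˡₚ : ∀ m {n o} → m + n ≡ₚ m + o → n ≡ₚ o
  +-cancelˡₚ m {n} {o} eq = begin
    n % p                       ≡⟨ [m+kn]%n≡m%n n m p ⟨
    (n + m * p) % p             ≡⟨ cong (_% p) (undo n) ⟩
    (pred p * m + (m + n)) % p  ≡⟨ +-congˡₚ (pred p * m) eq ⟩
    (pred p * m + (m + o)) % p  ≡⟨ cong (_% p) (undo o) ⟨
    (o + m * p) % p             ≡⟨ [m+kn]%n≡m%n o m p ⟩
    o % p                       ∎
    where
    open ≡-Reasoning
    undo : ∀ k → k + m * p ≡ pred p * m + (m + k)
    undo k = begin
      k + m * p                  ≡⟨ cong (λ q → k + m * q) (suc-pred p) ⟨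
      k + m * suc (pred p)       ≡⟨ identity k m (pred p) ⟩
      pred p * m + (m + k)       ∎
      where
      identity : ∀ k m q → k + m * suc q ≡ q * m + (m + k)
      identity = solve-∀

  opaque
    infixl 6 _⊕_
    _⊕_ : Fin p → ℕ → Fin p
    x ⊕ k = fromℕ< (m%n<n (toℕ x + k) p)

    toℕ-⊕ : ∀ x k → toℕ (x ⊕ k) ≡ (toℕ x + k) % p
    toℕ-⊕ x k = toℕ-fromℕ< (m%n<n (toℕ x + k) p)

  toℕ-%ₚ : ∀ (x : Fin p) → toℕ x % p ≡ toℕ x
  toℕ-%ₚ x = m<n⇒m%n≡m (toℕ<n x)

  ⊕-cong : ∀ x {m n} → m ≡ₚ n → x ⊕ m ≡ x ⊕ n
  ⊕-cong x {m} {n} m≡n = toℕ-injective (begin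
    toℕ (x ⊕ m)       ≡⟨ toℕ-⊕ x m ⟩
    (toℕ x + m) % p   ≡⟨ +-congˡₚ (toℕ x) m≡n ⟩
    (toℕ x + n) % p   ≡⟨ toℕ-⊕ x n ⟨
    toℕ (x ⊕ n)       ∎)
    where open ≡-Reasoning

  ⊕-cancel : ∀ x {m n} → x ⊕ m ≡ x ⊕ n → m ≡ₚ n
  ⊕-cancel x {m} {n} eq =
    +-cancelˡₚ (toℕ x) (trans (sym (toℕ-⊕ x m)) (trans (cong toℕ eq) (toℕ-⊕ x n)))

  ⊕-identityʳ : ∀ x → x ⊕ 0 ≡ x
  ⊕-identityʳ x = toℕ-injective (begin
    toℕ (x ⊕ 0)      ≡⟨ toℕ-⊕ x 0 ⟩
    (toℕ x + 0) % p  ≡⟨ cong (_% p) (+-identityʳ (toℕ x)) ⟩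
    toℕ x % p        ≡⟨ toℕ-%ₚ x ⟩
    toℕ x            ∎)
    where open ≡-Reasoning

  ⊕-assoc : ∀ x m n → x ⊕ m ⊕ n ≡ x ⊕ (m + n)
  ⊕-assoc x m n = toℕ-injective (begin
    toℕ (x ⊕ m ⊕ n)               ≡⟨ toℕ-⊕ (x ⊕ m) n ⟩
    (toℕ (x ⊕ m) + n) % p         ≡⟨ cong (λ k → (k + n) % p) (toℕ-⊕ x m) ⟩
    ((toℕ x + m) % p + n) % p     ≡⟨ cong (_% p) (+-comm _ n) ⟩
    (n + (toℕ x + m) % p) % p     ≡⟨ +-congˡₚ n (%-≡ₚ (toℕ x + m)) ⟩
    (n + (toℕ x + m)) % p         ≡⟨ cong (_% p) (trans (+-comm n _) (+-assoc (toℕ x) m n)) ⟩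
    (toℕ x + (m + n)) % p         ≡⟨ toℕ-⊕ x (m + n) ⟨
    toℕ (x ⊕ (m + n))             ∎)
    where open ≡-Reasoning

  subMod-spec : ∀ (y x : Fin p) → subMod y x < p × (toℕ x + subMod y x) % p ≡ toℕ y
  subMod-spec y x with toℕ x ≤ᵇ toℕ y in le
  ... | true = ≤-<-trans (m∸n≤m (toℕ y) (toℕ x)) (toℕ<n y) , (begin
    (toℕ x + (toℕ y ∸ toℕ x)) % p  ≡⟨ cong (_% p) (m+[n∸m]≡n x≤y) ⟩
    toℕ y % p                      ≡⟨ toℕ-%ₚ y ⟩
    toℕ y                          ∎)
    where
    open ≡-Reasoning
    x≤y = ≤ᵇ⇒≤ (toℕ x) (toℕ y) (subst T (sym le) _)
  ... | false = m<n+o⇒m∸n<o (toℕ y + p) (toℕ x) (+-monoˡ-< p y<x) , (begin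
    (toℕ x + (toℕ y + p ∸ toℕ x)) % p  ≡⟨ cong (_% p) (m+[n∸m]≡n (≤-trans (<⇒≤ (toℕ<n x)) (m≤n+m p (toℕ y)))) ⟩
    (toℕ y + p) % p                    ≡⟨ [m+n]%n≡m%n (toℕ y) p ⟩
    toℕ y % p                          ≡⟨ toℕ-%ₚ y ⟩
    toℕ y                              ∎)
    where
    open ≡-Reasoning
    y<x : toℕ y < toℕ x
    y<x = ≰⇒> (λ x≤y → subst T le (≤⇒≤ᵇ x≤y))

  subMod<p : ∀ (y x : Fin p) → subMod y x < p
  subMod<p y x = proj₁ (subMod-spec y x)

  ⊕-subMod : ∀ (y x : Fin p) → x ⊕ subMod y x ≡ y
  ⊕-subMod y x = toℕ-injective (trans (toℕ-⊕ x (subMod y x)) (proj₂ (subMod-spec y x)))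

  subMod-⊕ : ∀ x k → subMod (x ⊕ k) x ≡ k % p
  subMod-⊕ x k = begin
    subMod (x ⊕ k) x      ≡⟨ m<n⇒m%n≡m (subMod<p (x ⊕ k) x) ⟨
    subMod (x ⊕ k) x % p  ≡⟨ ⊕-cancel x (⊕-subMod (x ⊕ k) x) ⟩
    k % p                 ∎
    where open ≡-Reasoning

  subMod-injectiveˡ : ∀ {y y′} x → subMod y x ≡ subMod y′ x → y ≡ y′
  subMod-injectiveˡ {y} {y′} x eq =
    trans (sym (⊕-subMod y x)) (trans (cong (x ⊕_) eq) (⊕-subMod y′ x))

  subMod≡0⇒≡ : ∀ y x → subMod y x ≡ 0 → y ≡ x
  subMod≡0⇒≡ y x eq = trans (sym (⊕-subMod y x)) (trans (cong (x ⊕_) eq) (⊕-identityʳ x))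

module PrimeResidues (p : ℕ) (p-prime : Prime p) where

  private instance
    p≢0 : NonZero p
    p≢0 = prime⇒nonZero p-prime

  open Residues p

  private
    0%p≡0 : 0 % p ≡ 0
    0%p≡0 = m<n⇒m%n≡m (>-nonZero⁻¹ p)

    *-cancelʳₚ-≤ : ∀ {D} → 0 < D → D < p → ∀ {m n} → m ≤ n → n * D ≡ₚ m * D → n ≡ₚ m
    *-cancelʳₚ-≤ {D} 0<D D<p {m} {n} m≤n eq = begin
      n % p        ≡⟨ cong (_% p) (m+[n∸m]≡n m≤n) ⟨
      (m + j) % p  ≡⟨ +-congˡₚ m j≡0 ⟩
      (m + 0) % p  ≡⟨ cong (_% p) (+-identityʳ m) ⟩
      m % p        ∎
      where
      open ≡-Reasoning
      j : ℕ
      j = n ∸ m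
      jD≡0 : j * D ≡ₚ 0
      jD≡0 = +-cancelˡₚ (m * D) (begin
        (m * D + j * D) % p  ≡⟨ cong (_% p) (*-distribʳ-+ D m j) ⟨
        ((m + j) * D) % p    ≡⟨ cong (λ k → (k * D) % p) (m+[n∸m]≡n m≤n) ⟩
        (n * D) % p          ≡⟨ eq ⟩
        (m * D) % p          ≡⟨ cong (_% p) (+-identityʳ _) ⟨
        (m * D + 0) % p      ∎)
      j≡0 : j ≡ₚ 0
      j≡0 with euclidsLemma j D p-prime (m%n≡0⇒n∣m (j * D) p (trans jD≡0 0%p≡0))
      ... | inj₁ p∣j = trans (n∣m⇒m%n≡0 j p p∣j) (sym 0%p≡0)
      ... | inj₂ p∣D = contradiction (∣⇒≤ {{>-nonZero 0<D}} p∣D) (<⇒≱ D<p)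

  *-cancelʳₚ : ∀ {D} → 0 < D → D < p → ∀ m n → m * D ≡ₚ n * D → m ≡ₚ n
  *-cancelʳₚ 0<D D<p m n eq with ≤-total m n
  ... | inj₁ m≤n = sym (*-cancelʳₚ-≤ 0<D D<p m≤n (sym eq))
  ... | inj₂ n≤m = *-cancelʳₚ-≤ 0<D D<p n≤m eq

  ⊕-multiples-injective : ∀ {D} → 0 < D → D < p → ∀ x {m n} → m < p → n < p →
    x ⊕ m * D ≡ x ⊕ n * D → m ≡ n
  ⊕-multiples-injective 0<D D<p x {m} {n} m<p n<p eq = begin
    m      ≡⟨ m<n⇒m%n≡m m<p ⟨
    m % p  ≡⟨ *-cancelʳₚ 0<D D<p m n (⊕-cancel x eq) ⟩
    n % p  ≡⟨ m<n⇒m%n≡m n<p ⟩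
    n      ∎
    where open ≡-Reasoning

  subMod-⊕-multiples : ∀ {D} → 0 < D → D < p → ∀ x (a b : Fin p) n →
    subMod (x ⊕ toℕ a * D) (x ⊕ toℕ b * D) ≡ (n * D) % p → subMod a b ≡ n % p
  subMod-⊕-multiples {D} 0<D D<p x a b n eq = begin
    subMod a b      ≡⟨ m<n⇒m%n≡m (subMod<p a b) ⟨
    subMod a b % p  ≡⟨ ⊕-cancel b (trans (⊕-subMod a b) (sym b⊕n≡a)) ⟩
    n % p           ∎
    where
    open ≡-Reasoning
    u v : Fin p
    u = x ⊕ toℕ a * D
    v = x ⊕ toℕ b * D
    b+n≡a : toℕ b + n ≡ₚ toℕ a
    b+n≡a = *-cancelʳₚ 0<D D<p _ _ (begin
      ((toℕ b + n) * D) % p      ≡⟨ cong (_% p) (*-distribʳ-+ D (toℕ b) n) ⟩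
      (toℕ b * D + n * D) % p    ≡⟨ ⊕-cancel x (begin
        x ⊕ (toℕ b * D + n * D)    ≡⟨ ⊕-assoc x _ _ ⟨
        v ⊕ n * D                  ≡⟨ ⊕-cong v (trans (sym (%-≡ₚ (n * D))) (cong (_% p) (sym eq))) ⟩
        v ⊕ subMod u v             ≡⟨ ⊕-subMod u v ⟩
        u                          ∎) ⟩
      (toℕ a * D) % p            ∎)
    b⊕n≡a : b ⊕ n ≡ a
    b⊕n≡a = toℕ-injective (trans (toℕ-⊕ b n) (trans b+n≡a (toℕ-%ₚ a)))

module Configuration {N d : ℕ} (C : CoherentConfiguration N d) where

  open Counting

  ρ : Fin N → Fin N → Fin d
  ρ = r C

  _⋆ : Fin d → Fin d
  _⋆ = C *

  ≟-sound : ∀ {n} {a b : Fin n} → T (does (a ≟F b)) → a ≡ b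
  ≟-sound {a = a} {b} holds with a ≟F b
  ... | yes a≡b = a≡b

  ≟-complete : ∀ {n} {a b : Fin n} → a ≡ b → T (does (a ≟F b))
  ≟-complete {a = a} {b} a≡b with a ≟F b
  ... | yes _ = _
  ... | no a≢b = a≢b a≡b

  Path : Fin d → Fin d → Fin N → Fin N → Set
  Path s t α β = ∃[ γ ] (ρ α γ ≡ s × ρ γ β ≡ t)

  path⇒cAt>0 : ∀ {s t α β} → Path s t α β → 0 < cAt C s t α β
  path⇒cAt>0 (γ , αγ , γβ) = ∃⇒countFin>0 _ {γ}
    (Equivalence.from T-∧ (≟-complete αγ , ≟-complete γβ))

  cAt>0⇒path : ∀ {s t α β} → 0 < cAt C s t α β → Path s t α β
  cAt>0⇒path pos with γ , holds ← countFin>0⇒∃ _ pos =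
    γ , ≟-sound (proj₁ (Equivalence.to T-∧ holds)) , ≟-sound (proj₂ (Equivalence.to T-∧ holds))

  path-transfer : ∀ {s t α β α′ β′} → ρ α β ≡ ρ α′ β′ → Path s t α β → Path s t α′ β′
  path-transfer {s} {t} {α} {β} {α′} {β′} eq path =
    cAt>0⇒path (subst (0 <_) (coherent C s t α β α′ β′ eq) (path⇒cAt>0 path))

  source-fiber : ∀ {α β α′ β′} → ρ α β ≡ ρ α′ β′ → ρ α′ α′ ≡ ρ α α
  source-fiber {α} eq with path-transfer eq (α , refl , refl)
  ... | γ , α′γ , _ with diag C _ γ α α′γ
  ...   | refl = α′γ

  target-fiber : ∀ {α β α′ β′} → ρ α β ≡ ρ α′ β′ → ρ β′ β′ ≡ ρ β β
  target-fiber {β = β} eq with path-transfer eq (β , refl , refl)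
  ... | γ , _ , γβ′ with diag C γ _ β γβ′
  ...   | refl = γβ′

  ⋆-involutive : ∀ s → s ⋆ ⋆ ≡ s
  ⋆-involutive s with α , β , refl ← r-surj C s =
    trans (cong _⋆ (sym (conv C α β))) (sym (conv C β α))

  ρ-flip : ∀ {α β s} → ρ α β ≡ s → ρ β α ≡ s ⋆
  ρ-flip {α} {β} refl = conv C α β

  ρ-unflip : ∀ {α β s} → ρ α β ≡ s ⋆ → ρ β α ≡ s
  ρ-unflip {s = s} eq = trans (ρ-flip eq) (⋆-involutive s)

  colour-realised : ∀ {α β γ} → ρ γ γ ≡ ρ α α → ∃[ δ ] ρ γ δ ≡ ρ α β
  colour-realised {α} {β} eq with δ , γδ , _ ← path-transfer (sym eq) (β , refl , conv C α β) = δ , γδ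

  nval>0⇒∃ : ∀ {u α} → 0 < nval C u α → ∃[ β ] ρ α β ≡ u
  nval>0⇒∃ pos with β , holds ← countFin>0⇒∃ _ pos = β , ≟-sound holds

  cPos-intro : ∀ {s t α β} → Path s t α β → cPos C s t (ρ α β)
  cPos-intro {α = α} {β} path = α , β , refl , path⇒cAt>0 path

  cPos-elim : ∀ {s t u} → cPos C s t u → ∃[ α ] ∃[ β ] (ρ α β ≡ u × Path s t α β)
  cPos-elim (α , β , αβ , pos) = α , β , αβ , cAt>0⇒path pos

  InS-pair : ∀ {e f α β} → IsFiber C e → IsFiber C f → ρ α α ≡ e → ρ β β ≡ f → InS C e f (ρ α β)
  InS-pair fib-e fib-f α∈ β∈ = fib-e , fib-f , λ γ δ γδ →
    trans (source-fiber (sym γδ)) α∈ , trans (target-fiber (sym γδ)) β∈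

  InS-⋆ : ∀ {e f s} → InS C e f s → InS C f e (s ⋆)
  InS-⋆ (fib-e , fib-f , within) = fib-f , fib-e , λ α β αβ →
    proj₂ (within β α (ρ-unflip αβ)) , proj₁ (within β α (ρ-unflip αβ))

  σ∈σσ⋆σ : ∀ σ → cprod C (cprod C (single C σ) (single C (σ ⋆))) (single C σ) σ
  σ∈σσ⋆σ σ with α , β , refl ← r-surj C σ =
    ρ α α , ρ α β , (ρ α β , ρ α β ⋆ , refl , refl , cPos-intro (β , refl , conv C α β)) ,
    refl , cPos-intro (α , refl , refl)

module WreathFiber {N d : ℕ} (C : CoherentConfiguration N d) (p : ℕ) .{{_ : NonTrivial p}}
                   (E : Fin d) (iso : IsoWr C p E) where

  private instance
    p≢0 : NonZero p
    p≢0 = nonTrivial⇒nonZero p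

  open Configuration C
  open Residues p
  open Counting

  φ : Fin p × Fin p → Fin N
  φ = proj₁ iso

  φ-injective : Injective _≡_ _≡_ φ
  φ-injective = proj₁ (proj₂ iso)

  φ-∈ : ∀ x → ρ (φ x) (φ x) ≡ E
  φ-∈ = proj₁ (proj₂ (proj₂ iso))

  φ-surjective : ∀ {α} → ρ α α ≡ E → ∃[ x ] φ x ≡ α
  φ-surjective = proj₁ (proj₂ (proj₂ (proj₂ iso))) _

  colour⇒wrCol : ∀ {x y x′ y′} → ρ (φ x) (φ y) ≡ ρ (φ x′) (φ y′) → wrCol x y ≡ wrCol x′ y′
  colour⇒wrCol = Equivalence.to (proj₂ (proj₂ (proj₂ (proj₂ iso))) _ _ _ _)

  wrCol⇒colour : ∀ {x y x′ y′} → wrCol x y ≡ wrCol x′ y′ → ρ (φ x) (φ y) ≡ ρ (φ x′) (φ y′)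
  wrCol⇒colour = Equivalence.from (proj₂ (proj₂ (proj₂ (proj₂ iso))) _ _ _ _)

  wrCol-sameBlock : ∀ (x x′ y : Fin p) → wrCol (x , y) (x′ , y) ≡ inj₁ (subMod x′ x)
  wrCol-sameBlock x x′ y with y ≟F y
  ... | yes _ = refl
  ... | no y≢y = contradiction refl y≢y

  wrCol-otherBlock : ∀ (x x′ : Fin p) {y y′} → y ≢ y′ → wrCol (x , y) (x′ , y′) ≡ inj₂ (subMod y′ y)
  wrCol-otherBlock x x′ {y} {y′} y≢y′ with y ≟F y′
  ... | yes y≡y′ = contradiction y≡y′ y≢y′
  ... | no _ = refl

  colour-sameBlock : ∀ {x x′ y x″ x‴ y′ : Fin p} → ρ (φ (x , y)) (φ (x′ , y)) ≡ ρ (φ (x″ , y′)) (φ (x‴ , y′)) →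
    subMod x′ x ≡ subMod x‴ x″
  colour-sameBlock {x} {x′} {y} {x″} {x‴} {y′} eq = inj₁-injective (begin
    inj₁ (subMod x′ x)         ≡⟨ wrCol-sameBlock x x′ y ⟨
    wrCol (x , y) (x′ , y)     ≡⟨ colour⇒wrCol eq ⟩
    wrCol (x″ , y′) (x‴ , y′)  ≡⟨ wrCol-sameBlock x″ x‴ y′ ⟩
    inj₁ (subMod x‴ x″)        ∎)
    where open ≡-Reasoning

  sameBlock≢otherBlock : ∀ {x x′ y x″ x‴ y′ y″ : Fin p} → y′ ≢ y″ →
    ρ (φ (x , y)) (φ (x′ , y)) ≢ ρ (φ (x″ , y′)) (φ (x‴ , y″))
  sameBlock≢otherBlock {x} {x′} {y} {x″} {x‴} y′≢y″ eq =
    inj₁≢inj₂ (trans (sym (wrCol-sameBlock x x′ y)) (trans (colour⇒wrCol eq) (wrCol-otherBlock x″ x‴ y′≢y″)))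
    where
    inj₁≢inj₂ : ∀ {a b : ℕ} → inj₁ a ≢ inj₂ b
    inj₁≢inj₂ ()

  shift-colour : ∀ (x y x′ y′ : Fin p) k → ρ (φ (x , y)) (φ (x ⊕ k , y)) ≡ ρ (φ (x′ , y′)) (φ (x′ ⊕ k , y′))
  shift-colour x y x′ y′ k = wrCol⇒colour (begin
    wrCol (x , y) (x ⊕ k , y)      ≡⟨ wrCol-sameBlock x (x ⊕ k) y ⟩
    inj₁ (subMod (x ⊕ k) x)        ≡⟨ cong inj₁ (trans (subMod-⊕ x k) (sym (subMod-⊕ x′ k))) ⟩
    inj₁ (subMod (x′ ⊕ k) x′)      ≡⟨ wrCol-sameBlock x′ (x′ ⊕ k) y′ ⟨
    wrCol (x′ , y′) (x′ ⊕ k , y′)  ∎)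
    where open ≡-Reasoning

  record SameBlock (α β : Fin N) : Set where
    constructor sameBlock
    field
      block row₁ row₂ : Fin p
      at₁ : φ (row₁ , block) ≡ α
      at₂ : φ (row₂ , block) ≡ β

  SameBlock-sym : ∀ {α β} → SameBlock α β → SameBlock β α
  SameBlock-sym (sameBlock y x x′ at₁ at₂) = sameBlock y x′ x at₂ at₁

  SameBlock-trans : ∀ {α β γ} → SameBlock α β → SameBlock β γ → SameBlock α γ
  SameBlock-trans (sameBlock y x x′ refl refl) (sameBlock _ _ x‴ at refl) with refl ← φ-injective at =
    sameBlock y x x‴ refl refl

  SameBlock-∈ʳ : ∀ {α β} → SameBlock α β → ρ β β ≡ E
  SameBlock-∈ʳ (sameBlock _ _ _ _ refl) = φ-∈ _

  sameBlock-target-unique : ∀ {α β γ} → SameBlock α β → ρ α γ ≡ ρ α β → γ ≡ β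
  sameBlock-target-unique (sameBlock y x x′ refl refl) eq
    with (x″ , y″) , refl ← φ-surjective (trans (target-fiber (sym eq)) (φ-∈ _))
    with y ≟F y″
  ... | yes refl = cong (λ z → φ (z , y)) (subMod-injectiveˡ x (colour-sameBlock eq))
  ... | no y≢y″ = contradiction (sym eq) (sameBlock≢otherBlock y≢y″)

  sameBlock-colour : ∀ {α β γ δ} → SameBlock α β → ρ α β ≡ ρ γ δ → SameBlock γ δ
  sameBlock-colour (sameBlock y x x′ refl refl) eq
    with (x₁ , y₁) , refl ← φ-surjective (trans (source-fiber eq) (φ-∈ _))
       | (x₂ , y₂) , refl ← φ-surjective (trans (target-fiber eq) (φ-∈ _))
    with y₁ ≟F y₂
  ... | yes refl = sameBlock y₁ x₁ x₂ refl refl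
  ... | no y₁≢y₂ = contradiction eq (sameBlock≢otherBlock y₁≢y₂)

  otherBlock-colour : ∀ {α β γ} → ρ α α ≡ E → ¬ SameBlock α β → SameBlock β γ → ρ α γ ≡ ρ α β
  otherBlock-colour α∈ ¬αβ (sameBlock y₁ x₁ x₂ refl refl)
    with (x , y) , refl ← φ-surjective α∈
    with y ≟F y₁
  ... | yes refl = contradiction (sameBlock y x x₁ refl refl) ¬αβ
  ... | no y≢y₁ = wrCol⇒colour (trans (wrCol-otherBlock x x₂ y≢y₁) (sym (wrCol-otherBlock x x₁ y≢y₁)))

  private
    1<p : 1 < p
    1<p = nonTrivial⇒n>1 p

  thin⇒sameBlock : ∀ {u α β} → Thin C E u → ρ α β ≡ u → SameBlock α β
  thin⇒sameBlock {u} ((_ , _ , within) , valency) αβ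
    with (x , y) , refl ← φ-surjective (proj₁ (within _ _ αβ))
       | (x′ , y′) , refl ← φ-surjective (proj₂ (within _ _ αβ))
    with y ≟F y′
  ... | yes refl = sameBlock y x x′ refl refl
  ... | no y≢y′ = contradiction (subst (p ≤_) (valency _ (φ-∈ _)) block-counted) (<⇒≱ 1<p)
    where
    block-counted : p ≤ nval C u (φ (x , y))
    block-counted = injective⇒≤countFin _ (λ z → φ (z , y′)) (cong proj₁ ∘ φ-injective)
      λ z → ≟-complete (trans (wrCol⇒colour (trans (wrCol-otherBlock x z y≢y′) (sym (wrCol-otherBlock x x′ y≢y′)))) αβ)

  sameBlock⇒thin : ∀ {α β} → SameBlock α β → Thin C E (ρ α β)
  sameBlock⇒thin {α} {β} αβ@(sameBlock _ _ _ refl refl) =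
    InS-pair (α , φ-∈ _) (α , φ-∈ _) (φ-∈ _) (φ-∈ _) , valency-one
    where
    valency-one : ∀ γ → ρ γ γ ≡ E → nval C (ρ α β) γ ≡ 1
    valency-one γ γ∈ with δ , γδ ← colour-realised {α} {β} (trans γ∈ (sym (φ-∈ _))) =
      ≤-antisym (injective⇒countFin≤ _ (λ _ _ → zero) λ holds holds′ _ → trans (unique holds) (sym (unique holds′)))
                (∃⇒countFin>0 (λ ε → does (ρ γ ε ≟F ρ α β)) (≟-complete γδ))
      where
      unique : ∀ {ε} → T (does (ρ γ ε ≟F ρ α β)) → ε ≡ δ
      unique holds = sameBlock-target-unique (sameBlock-colour αβ (sym γδ)) (trans (≟-sound holds) (sym γδ))

  thinEquiv⇔sameBlock : ∀ {α β} → ThinEquiv C E α β ⇔ SameBlock α β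
  thinEquiv⇔sameBlock = mk⇔ (λ (_ , thin , αβ) → thin⇒sameBlock thin αβ) (λ αβ → _ , sameBlock⇒thin αβ , refl)

  Step : ℕ → Fin d → Set
  Step D g = ∀ x y → ρ (φ (x , y)) (φ (x ⊕ D , y)) ≡ g

  block-step : ∀ (x x′ y : Fin p) → Step (subMod x′ x) (ρ (φ (x , y)) (φ (x′ , y)))
  block-step x x′ y x₁ y₁ =
    trans (shift-colour x₁ y₁ x y (subMod x′ x)) (cong (λ z → ρ (φ (x , y)) (φ (z , y))) (⊕-subMod x′ x))

  thin-step : ∀ {g} → Thin C E g → g ≢ E → ∃[ D ] (0 < D × D < p × Step D g)
  thin-step {g} thin@(((α , α∈) , _) , valency) g≢E
    with β , αβ ← nval>0⇒∃ (subst (0 <_) (sym (valency α α∈)) (s≤s z≤n))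
    with sameBlock y x x′ refl refl ← thin⇒sameBlock thin αβ =
    subMod x′ x , n≢0⇒n>0 D≢0 , subMod<p x′ x , λ x₁ y₁ → trans (block-step x x′ y x₁ y₁) αβ
    where
    D≢0 : subMod x′ x ≢ 0
    D≢0 D≡0 = g≢E (trans (sym αβ) (trans (cong (λ z → ρ (φ (x , y)) (φ (z , y))) (subMod≡0⇒≡ x′ x D≡0)) (φ-∈ _)))

  iterate-step : ∀ {g D} → Step D g → ∀ n {x y γ} → Iter C g n (φ (x , y)) γ → γ ≡ φ (x ⊕ n * D , y)
  iterate-step step zero {x} {y} refl = cong (λ z → φ (z , y)) (sym (⊕-identityʳ x))
  iterate-step {D = D} step (suc n) {x} {y} (δ , xδ , rest)
    with refl ← sameBlock-target-unique (sameBlock y x (x ⊕ D) refl refl) (trans xδ (sym (step x y))) =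
    trans (iterate-step step n rest) (cong (λ z → φ (z , y)) (⊕-assoc x D (n * D)))

module NonRegularColour {N d : ℕ} (C : CoherentConfiguration N d) (p : ℕ) (p-prime : Prime p)
    (E : Fin d) (iso : IsoWr C p E) (σ : Fin d)
    (σ-source∈ : ∀ {α β} → r C α β ≡ σ → r C α α ≡ E)
    (σ⋆-valency : ∀ {α γ} → r C α γ ≡ σ → nval C ((C *) σ) γ ≡ p)
    (¬regular : ¬ Regular C σ) where

  private instance
    p-nonTrivial : NonTrivial p
    p-nonTrivial = prime⇒nonTrivial p-prime
    p≢0 : NonZero p
    p≢0 = nonTrivial⇒nonZero p

  open Configuration C
  open Residues p
  open PrimeResidues p p-prime
  open WreathFiber C p E iso
  open Counting

  -- Two σ-sources in one block force σ to be regular.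
  private
    module SharedTarget {x₀ x₁ y₀ : Fin p} {γ : Fin N} (x₀≢x₁ : x₀ ≢ x₁)
        (σ₀ : ρ (φ (x₀ , y₀)) γ ≡ σ) (σ₁ : ρ (φ (x₁ , y₀)) γ ≡ σ) where

      D : ℕ
      D = subMod x₁ x₀

      0<D : 0 < D
      0<D = n≢0⇒n>0 (λ D≡0 → x₀≢x₁ (sym (subMod≡0⇒≡ x₁ x₀ D≡0)))

      σ-step : ∀ {a b z} → ρ (φ (a , b)) z ≡ σ → ρ (φ (a ⊕ D , b)) z ≡ σ
      σ-step {a} {b} az with δ , aδ , δz ← path-transfer (trans σ₀ (sym az)) (φ (x₁ , y₀) , refl , σ₁)
        with refl ← sameBlock-target-unique (sameBlock b a (a ⊕ D) refl refl) (trans aδ (sym (block-step x₀ x₁ y₀ a b))) = δz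

      σ-shift : ∀ n {a b z} → ρ (φ (a , b)) z ≡ σ → ρ (φ (a ⊕ n * D , b)) z ≡ σ
      σ-shift zero {a} {b} {z} az = subst (λ w → ρ (φ (w , b)) z ≡ σ) (sym (⊕-identityʳ a)) az
      σ-shift (suc n) {a} {b} {z} az = subst (λ w → ρ (φ (w , b)) z ≡ σ) (⊕-assoc a D (n * D)) (σ-shift n (σ-step az))

      -- Otherwise w has the p points a ⊕ n D of one block and one further point as σ⋆-neighbours.
      σ-sources-in-one-block : ∀ {a b a′ b′ w} → ρ (φ (a , b)) w ≡ σ → ρ (φ (a′ , b′)) w ≡ σ → b′ ≡ b
      σ-sources-in-one-block {a} {b} {a′} {b′} {w} aw a′w with b′ ≟F b
      ... | yes b′≡b = b′≡b
      ... | no b′≢b = contradiction (subst (suc p ≤_) (σ⋆-valency aw) counted) (n≮n p)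
        where
        ι : Fin (suc p) → Fin N
        ι zero = φ (a′ , b′)
        ι (suc i) = φ (a ⊕ toℕ i * D , b)
        ι-injective : Injective _≡_ _≡_ ι
        ι-injective {zero} {zero} _ = refl
        ι-injective {zero} {suc _} eq = contradiction (cong proj₂ (φ-injective eq)) b′≢b
        ι-injective {suc _} {zero} eq = contradiction (sym (cong proj₂ (φ-injective eq))) b′≢b
        ι-injective {suc i} {suc j} eq = cong suc (toℕ-injective
          (⊕-multiples-injective 0<D (subMod<p x₁ x₀) a (toℕ<n i) (toℕ<n j) (cong proj₁ (φ-injective eq))))
        counted : suc p ≤ nval C (σ ⋆) w
        counted = injective⇒≤countFin _ ι ι-injective λ where
          zero → ≟-complete (ρ-flip a′w)
          (suc i) → ≟-complete (ρ-flip (σ-shift (toℕ i) aw))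

      σ-zigzag : ∀ {α w z β} → ρ α w ≡ σ → ρ z w ≡ σ → ρ z β ≡ σ → ρ α β ≡ σ
      σ-zigzag αw zw zβ
        with (a , b) , refl ← φ-surjective (σ-source∈ αw)
           | (a′ , b′) , refl ← φ-surjective (σ-source∈ zw)
        with refl ← σ-sources-in-one-block αw zw
        with δ , zδ , δβ ← path-transfer (trans zw (sym zβ)) (φ (a , b) , refl , αw)
        with refl ← sameBlock-target-unique (sameBlock b a′ a refl refl) zδ = δβ

      σσ⋆σ⊆σ : ∀ w → cprod C (cprod C (single C σ) (single C (σ ⋆))) (single C σ) w → w ≡ σ
      σσ⋆σ⊆σ w (t , _ , (_ , _ , refl , refl , σσ⋆∋t) , refl , tσ∋w)
        with _ , _ , refl , path ← cPos-elim σσ⋆∋t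
           | α , β , refl , z , αz , zβ ← cPos-elim tσ∋w
        with y , αy , yz ← path-transfer (sym αz) path = σ-zigzag αy (ρ-unflip yz) zβ

      regular : Regular C σ
      regular w = mk⇔ (σσ⋆σ⊆σ w) λ { refl → σ∈σσ⋆σ σ }

  σ-source-unique-in-block : ∀ {β β′ γ} → SameBlock β β′ → ρ β γ ≡ σ → ρ β′ γ ≡ σ → β ≡ β′
  σ-source-unique-in-block (sameBlock y x x′ refl refl) βγ β′γ with x ≟F x′
  ... | yes refl = refl
  ... | no x≢x′ = contradiction (SharedTarget.regular x≢x′ βγ β′γ) ¬regular

  -- Otherwise the σ-sources of γ lie in distinct blocks other than y, so there are fewer than p.
  σ-source-in-every-block : ∀ {α γ} → ρ α γ ≡ σ → ∀ y → ∃[ x ] ρ (φ (x , y)) γ ≡ σ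
  σ-source-in-every-block {α} {γ} αγ y with any? (λ x → ρ (φ (x , y)) γ ≟F σ)
  ... | yes found = found
  ... | no none = contradiction (σ⋆-valency αγ) (<⇒≢ too-few)
    where
    source : ∀ {ε} → T (does (ρ γ ε ≟F σ ⋆)) → ρ ε γ ≡ σ
    source holds = ρ-unflip (≟-sound holds)
    coordinates : ∀ ε → T (does (ρ γ ε ≟F σ ⋆)) → ∃[ xy ] φ xy ≡ ε
    coordinates ε holds = φ-surjective (σ-source∈ (source holds))
    block : ∀ ε → T (does (ρ γ ε ≟F σ ⋆)) → Fin p
    block ε holds = proj₂ (proj₁ (coordinates ε holds))
    block-injective : ∀ {ε ε′} holds holds′ → block ε holds ≡ block ε′ holds′ → ε ≡ ε′
    block-injective {ε} {ε′} holds holds′ eq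
      with (x , _) , refl ← coordinates ε holds | (x′ , _) , refl ← coordinates ε′ holds′
      with refl ← eq = σ-source-unique-in-block (sameBlock _ x x′ refl refl) (source holds) (source holds′)
    block≢y : ∀ ε holds → block ε holds ≢ y
    block≢y ε holds eq with (x , _) , refl ← coordinates ε holds =
      none (x , subst (λ b → ρ (φ (x , b)) γ ≡ σ) eq (source holds))
    too-few : nval C (σ ⋆) γ < p
    too-few = injective⇒countFin< _ block block-injective y block≢y

module GeneralizedHadamard {N d : ℕ} (C : CoherentConfiguration N d) (p : ℕ) (p-prime : Prime p)
    {e f s : Fin d} (iso-e : IsoWr C p e) (iso-f : IsoWr C p f) (s∈ : InS C e f s)
    (s-valency : ∀ {α} → r C α α ≡ e → nval C s α ≡ p)
    (s⋆-valency : ∀ {γ} → r C γ γ ≡ f → nval C ((C *) s) γ ≡ p)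
    (¬regular-s : ¬ Regular C s) (¬regular-s⋆ : ¬ Regular C ((C *) s)) where

  private instance
    p≢0 : NonZero p
    p≢0 = prime⇒nonZero p-prime

  open Configuration C
  open Residues p
  open PrimeResidues p p-prime
  private
    module Fe = WreathFiber C p {{prime⇒nonTrivial p-prime}} e iso-e
    module Ff = WreathFiber C p {{prime⇒nonTrivial p-prime}} f iso-f

    s-fibers : ∀ {α γ} → ρ α γ ≡ s → ρ α α ≡ e × ρ γ γ ≡ f
    s-fibers = proj₂ (proj₂ s∈) _ _

    module Ns = NonRegularColour C p p-prime e iso-e s (proj₁ ∘ s-fibers) (s⋆-valency ∘ proj₂ ∘ s-fibers) ¬regular-s
    module Ns⋆ = NonRegularColour C p p-prime f iso-f (s ⋆) (proj₂ ∘ s-fibers ∘ ρ-unflip)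
      (λ αγ → subst (λ u → nval C u _ ≡ p) (sym (⋆-involutive s)) (s-valency (proj₁ (s-fibers (ρ-unflip αγ)))))
      ¬regular-s⋆

  s-target-unique-in-block : ∀ {α γ γ′} → Ff.SameBlock γ γ′ → ρ α γ ≡ s → ρ α γ′ ≡ s → γ ≡ γ′
  s-target-unique-in-block γγ′ αγ αγ′ = Ns⋆.σ-source-unique-in-block γγ′ (ρ-flip αγ) (ρ-flip αγ′)

  s-target-exists : ∀ {α} → ρ α α ≡ e → ∃[ γ ] ρ α γ ≡ s
  s-target-exists α∈ with α₀ , γ₀ , α₀γ₀ ← r-surj C s
    with γ , αγ ← colour-realised {α₀} {γ₀} (trans α∈ (sym (proj₁ (s-fibers α₀γ₀)))) = γ , trans αγ α₀γ₀

  s-source-in-every-block : ∀ {γ} → ρ γ γ ≡ f → ∀ y → ∃[ x ] ρ (Fe.φ (x , y)) γ ≡ s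
  s-source-in-every-block γ∈ with α₀ , γ₀ , α₀γ₀ ← r-surj C s
    with δ , γδ ← colour-realised {γ₀} {α₀} (trans γ∈ (sym (proj₂ (s-fibers α₀γ₀)))) =
    Ns.σ-source-in-every-block (ρ-unflip (trans γδ (ρ-flip α₀γ₀)))

  colour-along-block : ∀ {α β γ γ′} → Fe.SameBlock α β → ρ α γ ≡ s → ρ α γ′ ≡ s → ρ β γ′ ≡ ρ β γ
  colour-along-block αβ αγ αγ′ with δ , αδ , δγ′ ← path-transfer (trans αγ (sym αγ′)) (_ , refl , refl)
    with refl ← Fe.sameBlock-target-unique αβ αδ = δγ′

  module Matrix {g : Fin d} (thin-g : Thin C f g) (g≢f : g ≢ f)
      (rep-e rep-f : Fin p → Fin N)
      (rep-e∈ : ∀ k → ρ (rep-e k) (rep-e k) ≡ e)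
      (rep-e-distinct : ∀ k k′ → ThinEquiv C e (rep-e k) (rep-e k′) → k ≡ k′)
      (rep-f∈ : ∀ l → ρ (rep-f l) (rep-f l) ≡ f)
      (rep-f-cover : ∀ {β} → ρ β β ≡ f → ∃[ l ] ThinEquiv C f (rep-f l) β)
      (h : Fin p → Fin p → Fin p)
      (h-spec : ∀ k l → ∃[ γ ] (Iter C g (toℕ (h k l)) (rep-f l) γ × ρ (rep-e k) γ ≡ s)) where

    private
      g-step : ∃[ D ] (0 < D × D < p × Ff.Step D g)
      g-step = Ff.thin-step thin-g g≢f

      D : ℕ
      D = proj₁ g-step

      0<D : 0 < D
      0<D = proj₁ (proj₂ g-step)

      D<p : D < p
      D<p = proj₁ (proj₂ (proj₂ g-step))

      coordinates : ∀ l → ∃[ xy ] Ff.φ xy ≡ rep-f l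
      coordinates l = Ff.φ-surjective (rep-f∈ l)

    -- G k l is the paper's α_{jl} t_j^{h(s)_{kl}}.
    G : Fin p → Fin p → Fin N
    G k l = proj₁ (h-spec k l)

    G-colour : ∀ k l → ρ (rep-e k) (G k l) ≡ s
    G-colour k l = proj₂ (proj₂ (h-spec k l))

    G-coordinates : ∀ k l →
      G k l ≡ Ff.φ (proj₁ (proj₁ (coordinates l)) ⊕ toℕ (h k l) * D , proj₂ (proj₁ (coordinates l)))
    G-coordinates k l = Ff.iterate-step (proj₂ (proj₂ (proj₂ g-step))) (toℕ (h k l))
      (subst (λ β → Iter C g (toℕ (h k l)) β (G k l)) (sym (proj₂ (coordinates l))) (proj₁ (proj₂ (h-spec k l))))

    G-sameBlock : ∀ k l → Ff.SameBlock (rep-f l) (G k l)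
    G-sameBlock k l = Ff.sameBlock _ _ _ (proj₂ (coordinates l)) (sym (G-coordinates k l))

    G-unique : ∀ {k l γ} → ρ (rep-e k) γ ≡ s → Ff.SameBlock (rep-f l) γ → γ ≡ G k l
    G-unique {k} {l} αγ lγ =
      s-target-unique-in-block (Ff.SameBlock-trans (Ff.SameBlock-sym lγ) (G-sameBlock k l)) αγ (G-colour k l)

    private
      block : Fin p → Fin p
      block k = proj₂ (proj₁ (Fe.φ-surjective (rep-e∈ k)))

      in-block : ∀ k x → Fe.SameBlock (rep-e k) (Fe.φ (x , block k))
      in-block k x = Fe.sameBlock (block k) _ x (proj₂ (Fe.φ-surjective (rep-e∈ k))) refl

      colour-into-other-block : ∀ {k₁ k₂} → k₁ ≢ k₂ → ∀ x x′ →
        ρ (rep-e k₁) (Fe.φ (x , block k₂)) ≡ ρ (rep-e k₁) (Fe.φ (x′ , block k₂))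
      colour-into-other-block {k₁} {k₂} k₁≢k₂ x x′ =
        trans (Fe.otherBlock-colour (rep-e∈ k₁) ¬αα′ (in-block k₂ x)) (sym (Fe.otherBlock-colour (rep-e∈ k₁) ¬αα′ (in-block k₂ x′)))
        where
        ¬αα′ : ¬ Fe.SameBlock (rep-e k₁) (rep-e k₂)
        ¬αα′ αα′ = k₁≢k₂ (rep-e-distinct k₁ k₂ (Equivalence.from Fe.thinEquiv⇔sameBlock αα′))

    -- Opaque: type-checking the uses of this witness must not unfold its proof.
    opaque
      -- Let β be the s-source of τ in the block of α′ = rep-e k₂. Since α = rep-e k₁ sees that whole
      -- block in one colour, coherence yields an s-target γ of α with γ s⋆ β, say γ = G k₁ l; carrying
      -- the edge β → τ over to block l puts G k₁ l at the offset of τ from ν, relative to G k₂ l.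
      every-offset : ∀ {k₁ k₂} → k₁ ≢ k₂ → ∀ {ν τ} → ρ (rep-e k₂) ν ≡ s → Ff.SameBlock ν τ →
        ∃[ l ] ρ (G k₂ l) (G k₁ l) ≡ ρ ν τ
      every-offset {k₁} {k₂} k₁≢k₂ {ν} {τ} α′ν ντ
        with x , βτ ← s-source-in-every-block (Ff.SameBlock-∈ʳ ντ) (block k₂)
        with γ₁ , αγ₁ ← s-target-exists (rep-e∈ k₁)
        with x₁ , β₁γ₁ ← s-source-in-every-block (proj₂ (s-fibers αγ₁)) (block k₂)
        with γ , αγ , γβ ← path-transfer (colour-into-other-block k₁≢k₂ x₁ x) (γ₁ , αγ₁ , ρ-flip β₁γ₁)
        with l , lγ ← rep-f-cover (proj₂ (s-fibers αγ))
        with ε , βε , ετ ← path-transfer (colour-along-block (in-block k₂ x) (G-colour k₂ l) α′ν) (τ , βτ , refl)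
        with refl ← s-target-unique-in-block (Ff.SameBlock-trans (Ff.sameBlock-colour (Ff.SameBlock-sym ντ) (sym ετ))
                     (Ff.SameBlock-trans (Ff.SameBlock-sym (G-sameBlock k₂ l)) (Equivalence.to Ff.thinEquiv⇔sameBlock lγ)))
                     βε (ρ-unflip γβ)
        with refl ← G-unique αγ (Equivalence.to Ff.thinEquiv⇔sameBlock lγ) =
        l , trans (ρ-flip ετ) (sym (conv C τ ν))

    generalized-hadamard : ∀ {k₁ k₂} → k₁ ≢ k₂ → ∀ c → ∃[ l ] subMod (h k₁ l) (h k₂ l) ≡ toℕ c
    generalized-hadamard {k₁} {k₂} k₁≢k₂ c
      with ν , α′ν ← s-target-exists (rep-e∈ k₂)
      with (X , Y) , refl ← Ff.φ-surjective (proj₂ (s-fibers α′ν))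
      with l , offset ← every-offset k₁≢k₂ α′ν (Ff.sameBlock Y X (X ⊕ toℕ c * D) refl refl) =
      l , (begin
        subMod (h k₁ l) (h k₂ l)  ≡⟨ subMod-⊕-multiples 0<D D<p x (h k₁ l) (h k₂ l) (toℕ c) (begin
          subMod (x ⊕ toℕ (h k₁ l) * D) (x ⊕ toℕ (h k₂ l) * D)  ≡⟨ Ff.colour-sameBlock
              (subst₂ (λ γ γ′ → ρ γ γ′ ≡ _) (G-coordinates k₂ l) (G-coordinates k₁ l) offset) ⟩
          subMod (X ⊕ toℕ c * D) X                              ≡⟨ subMod-⊕ X (toℕ c * D) ⟩
          (toℕ c * D) % p                                       ∎) ⟩
        toℕ c % p                 ≡⟨ toℕ-%ₚ c ⟩
        toℕ c                     ∎)
      where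
      open ≡-Reasoning
      x : Fin p
      x = proj₁ (proj₁ (coordinates l))

module BasePoints {N d : ℕ} (C : CoherentConfiguration N d) (p : ℕ) (p-prime : Prime p) (base : Fin d → Fin N) where

  open Configuration C

  compatible-thin-nontrivial : ∀ {e₁ f t₁ g} → IsoWr C p e₁ →
    ρ (base e₁) (base e₁) ≡ e₁ → ρ (base f) (base f) ≡ f → Thin C e₁ t₁ → t₁ ≢ e₁ →
    (∀ γ δ → ρ (base e₁) γ ≡ t₁ → ρ (base f) δ ≡ g → ρ γ δ ≡ ρ (base e₁) (base f)) →
    (e₁ ≢ f → ¬ Regular C (ρ (base e₁) (base f))) →
    (e₁ ≢ f → ∀ {γ} → ρ γ γ ≡ f → nval C (ρ (base e₁) (base f) ⋆) γ ≡ p) →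
    g ≢ f
  compatible-thin-nontrivial {e₁} {f} iso₁ b₁∈ b∈ thin₁ t₁≢e₁ compatible ¬regular valency g≡f
    with γ₁ , b₁γ₁ ← nval>0⇒∃ (subst (0 <_) (sym (proj₂ thin₁ _ b₁∈)) z<s)
    with key ← compatible γ₁ (base f) b₁γ₁ (trans b∈ (sym g≡f))
    with f ≟F e₁
  ... | yes refl = t₁≢e₁ (trans (sym b₁γ₁) (trans (cong (ρ (base e₁)) (diag C γ₁ _ _ key)) b₁∈))
  ... | no f≢e₁ = t₁≢e₁ (trans (sym b₁γ₁) (trans (cong (ρ (base e₁)) (sym b₁≡γ₁)) b₁∈))
    where
    e₁≢f : e₁ ≢ f
    e₁≢f = ≢-sym f≢e₁
    b₁≡γ₁ : base e₁ ≡ γ₁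
    b₁≡γ₁ = NonRegularColour.σ-source-unique-in-block C p p-prime e₁ iso₁ (ρ (base e₁) (base f))
      (λ αβ → trans (source-fiber (sym αβ)) b₁∈) (λ αγ → valency e₁≢f (trans (target-fiber (sym αγ)) b∈)) (¬regular e₁≢f)
      (WreathFiber.thin⇒sameBlock C p {{prime⇒nonTrivial p-prime}} e₁ iso₁ thin₁ b₁γ₁) refl key

proposition3p1 :
  ∀ (p : ℕ) → Prime p →
  ∀ {N d : ℕ} (C : CoherentConfiguration N d) →
  -- (Ω_i, S_i) ≃ C_p ≀ C_p for every fiber
  (∀ e → IsFiber C e → IsoWr C p e) →
  -- n_s = p for s ∈ S_ij, i ≠ j
  (∀ e f s → e ≢ f → InS C e f s → ∀ α → _∈F_ C α e → nval C s α ≡ p) →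
  -- S = ⋃ S_i ∪ (S ∖ R)
  (∀ e f s → e ≢ f → InS C e f s → ¬ Regular C s) →
  -- the fiber Ω_1, base points α_i ∈ Ω_i
  ∀ (e₁ : Fin d) → IsFiber C e₁ →
  ∀ (base : Fin d → Fin N) → (∀ e → IsFiber C e → _∈F_ C (base e) e) →
  -- t_1 ∈ O_θ(S_1) ∖ {1_{Ω_1}}
  ∀ (t₁ : Fin d) → Thin C e₁ t₁ → t₁ ≢ e₁ →
  -- t_i ∈ O_θ(S_i) with r(α_1 t_1, α_i t_i) = r(α_1, α_i)
  ∀ (t : Fin d → Fin d) →
  (∀ e → IsFiber C e → Thin C e (t e) ×
    (∀ γ δ → r C (base e₁) γ ≡ t₁ → r C (base e) δ ≡ t e →
      r C γ δ ≡ r C (base e₁) (base e))) →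
  -- complete sets of representatives α_{ik}, k = 1..p
  ∀ (rep : Fin d → Fin p → Fin N) →
  (∀ e → IsFiber C e →
    (∀ k → _∈F_ C (rep e k) e) ×
    (∀ β → _∈F_ C β e → ∃[ k ] ThinEquiv C e (rep e k) β) ×
    (∀ k k′ → ThinEquiv C e (rep e k) (rep e k′) → k ≡ k′)) →
  -- s ∈ S_ij, i ≠ j, and h(s)_{kl} with r(α_{ik}, α_{jl} t_j^{h(s)_{kl}}) = s
  ∀ (e f s : Fin d) → e ≢ f → InS C e f s →
  ∀ (h : Fin p → Fin p → Fin p) →
  (∀ k l → ∃[ γ ] (Iter C (t f) (toℕ (h k l)) (rep f l) γ × r C (rep e k) γ ≡ s)) →
  -- conclusion: generalized Hadamard matrix over ℤ_p
  ∀ (k₁ k₂ : Fin p) → k₁ ≢ k₂ →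
  ∀ (a : Fin p) → ∃[ l ] subMod (h k₁ l) (h k₂ l) ≡ toℕ a
proposition3p1 p p-prime C isos valency nonregular e₁ fib₁ base base∈ t₁ thin₁ t₁≢e₁ t t-spec rep rep-spec
               e f s e≢f s∈ h h-spec k₁ k₂ k₁≢k₂ =
  Hadamard.Matrix.generalized-hadamard (proj₁ (t-spec f fib-f)) t-f≢f (rep e) (rep f)
    (proj₁ (rep-spec e fib-e)) (proj₂ (proj₂ (rep-spec e fib-e)))
    (proj₁ (rep-spec f fib-f)) (proj₁ (proj₂ (rep-spec f fib-f)) _) h h-spec k₁≢k₂
  where
  open Configuration C using (InS-pair; InS-⋆)

  fib-e : IsFiber C e
  fib-e = proj₁ s∈

  fib-f : IsFiber C f
  fib-f = proj₁ (proj₂ s∈)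

  module Hadamard = GeneralizedHadamard C p p-prime (isos e fib-e) (isos f fib-f) s∈
    (valency e f s e≢f s∈ _) (valency f e _ (≢-sym e≢f) (InS-⋆ s∈) _)
    (nonregular e f s e≢f s∈) (nonregular f e _ (≢-sym e≢f) (InS-⋆ s∈))

  s₀∈ : InS C e₁ f (r C (base e₁) (base f))
  s₀∈ = InS-pair fib₁ fib-f (base∈ e₁ fib₁) (base∈ f fib-f)

  t-f≢f : t f ≢ f
  t-f≢f = BasePoints.compatible-thin-nontrivial C p p-prime base (isos e₁ fib₁) (base∈ e₁ fib₁) (base∈ f fib-f)
    thin₁ t₁≢e₁ (proj₂ (t-spec f fib-f))
    (λ e₁≢f → nonregular e₁ f _ e₁≢f s₀∈) (λ e₁≢f → valency f e₁ _ (≢-sym e₁≢f) (InS-⋆ s₀∈) _)
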